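{- Let $\nu$ be a lattice path and $T,T'$ be $\nu$-trees such that $T'$ is obtained from $T$ by a nonempty sequence of right rotations. Then $b(T)<b(T')$ componentwise, i.e. $b(T)\le b(T')$ in every coordinate and $b(T)\ne b(T')$.
   Context: $\nu$ is a lattice path of unit north and east steps from $(0,0)$ to $(m,n)$. $F_\nu$ is the Ferrers diagram weakly above $\nu$ inside $[0,m]\times[0,n]$, $A_\nu$ its lattice points. Points of $A_\nu$ are $\nu$-incompatible if one lies strictly southwest of the other and the smallest axis-parallel rectangle containing them lies in $F_\nu$; a $\nu$-tree is an inclusion-maximal set of pairwise $\nu$-compatible points. Binary tree of $T$: root $(0,n)$; the parent of another node $p$ is the nearest point of $T$ strictly above $p$ in its column ($p$ a left child) or the nearest point of $T$ strictly left of $p$ in its row ($p$ a right child). $b(T)$ is the sequence of $y$-coordinates of nodes read in in-order (left subtree, root, right subtree). Right rotation: $T'=(T\setminus\{q\})\cup\{q'\}$ where $p,q,r\in T$, $q$ strictly below $p$ in its column, $r$ strictly right of $q$ in its row, $q'$ in the column of $r$ and row of $p$, no other point of $T$ on $[p,q],[q,r]$ and no other point of $T'$ on $[p,q'],[q',r]$. -}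

module Defs where

open import Data.Nat using (ℕ; zero; suc; _+_; _∸_; _≤_; _<_; _≡ᵇ_)
open import Data.Bool using (Bool; true; false; if_then_else_; _∧_; _∨_; not)
open import Data.List using (List; []; _∷_; _++_)
open import Data.Maybe using (Maybe; just; nothing; maybe)
open import Data.Product using (_×_; _,_; proj₁; proj₂; Σ; ∃)
open import Data.Sum using (_⊎_)
open import Relation.Nullary using (¬_)
open import Relation.Binary.PropositionalEquality using (_≡_)
open import Relation.Binary.Construct.Closure.Transitive using (TransClosure)

data Step : Set where
  N E : Step

Path : Set
Path = List Step

width : Path → ℕ
width []      = 0
width (N ∷ s) = width s
width (E ∷ s) = suc (width s)

height : Path → ℕ
height []      = 0
height (N ∷ s) = suc (height s)
height (E ∷ s) = height s

-- lowAt ν x = lowest height of the path ν on the vertical line at abscissa x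
-- (number of N steps before the x-th E step; 0 for x = 0).
lowAt : Path → ℕ → ℕ
lowAt s       zero    = 0
lowAt []      (suc x) = 0
lowAt (N ∷ s) (suc x) = suc (lowAt s (suc x))
lowAt (E ∷ s) (suc x) = lowAt s x

Point : Set
Point = ℕ × ℕ

-- A_ν : lattice points of the Ferrers diagram F_ν (weakly above ν inside [0,m]×[0,n])
InA : Path → Point → Set
InA ν (x , y) = x ≤ width ν × y ≤ height ν × lowAt ν x ≤ y

StrictSW : Point → Point → Set
StrictSW (x₁ , y₁) (x₂ , y₂) = x₁ < x₂ × y₁ < y₂

-- the rectangle with lower-left corner p and upper-right corner q lies in F_ν
-- (F_ν is a union of unit cells, so this is the case iff all lattice points
-- of the rectangle lie in A_ν)
RectIn : Path → Point → Point → Set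
RectIn ν (x₁ , y₁) (x₂ , y₂) =
  ∀ x y → x₁ ≤ x → x ≤ x₂ → y₁ ≤ y → y ≤ y₂ → InA ν (x , y)

Incompatible : Path → Point → Point → Set
Incompatible ν p q = (StrictSW p q × RectIn ν p q) ⊎ (StrictSW q p × RectIn ν q p)

Compatible : Path → Point → Point → Set
Compatible ν p q = ¬ Incompatible ν p q

PointSet : Set
PointSet = Point → Bool

_∈ₚ_ : Point → PointSet → Set
a ∈ₚ S = S a ≡ true

_⊆ₚ_ : PointSet → PointSet → Set
S ⊆ₚ S' = ∀ a → a ∈ₚ S → a ∈ₚ S'

IsCompatibleSet : Path → PointSet → Set
IsCompatibleSet ν S =
  (∀ a → a ∈ₚ S → InA ν a) × (∀ a b → a ∈ₚ S → b ∈ₚ S → Compatible ν a b)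

IsνTree : Path → PointSet → Set
IsνTree ν T = IsCompatibleSet ν T ×
  (∀ S → IsCompatibleSet ν S → T ⊆ₚ S → S ⊆ₚ T)

nearestBelow : PointSet → ℕ → ℕ → Maybe ℕ
nearestBelow T x zero    = nothing
nearestBelow T x (suc k) = if T (x , k) then just k else nearestBelow T x k

nearestRight : PointSet → ℕ → ℕ → ℕ → Maybe ℕ
nearestRight T y x zero    = nothing
nearestRight T y x (suc k) =
  if T (suc x , y) then just (suc x) else nearestRight T y (suc x) k

-- Left child of p = nearest point of T strictly below p in its column,
-- right child of p = nearest point of T strictly right of p in its row
-- (exactly the inverse of the paper's parent relation). The fuel argument
-- bounds the depth; x + (n - y) strictly increases along tree edges, so
-- fuel m + n + 1 suffices.
inorder : Path → PointSet → ℕ → Point → List ℕ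
inorder ν T zero       p       = []
inorder ν T (suc fuel) (x , y) =
  maybe (λ y' → inorder ν T fuel (x , y')) [] (nearestBelow T x y)
  ++ (y ∷ [])
  ++ maybe (λ x' → inorder ν T fuel (x' , y)) [] (nearestRight T y x (width ν ∸ x))

bvec : Path → PointSet → List ℕ
bvec ν T = inorder ν T (suc (width ν + height ν)) (0 , height ν)

_==ₚ_ : Point → Point → Bool
(x₁ , y₁) ==ₚ (x₂ , y₂) = (x₁ ≡ᵇ x₂) ∧ (y₁ ≡ᵇ y₂)

-- closed axis-parallel box with lower-left corner lo and upper-right corner hi
-- (used for the segments [p,q] etc., which are degenerate boxes)
InBox : Point → Point → Point → Set
InBox (x₁ , y₁) (x₂ , y₂) (x , y) = x₁ ≤ x × x ≤ x₂ × y₁ ≤ y × y ≤ y₂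

NoOtherOn : PointSet → Point → Point → Set
NoOtherOn S lo hi = ∀ a → a ∈ₚ S → InBox lo hi a → a ≡ lo ⊎ a ≡ hi

RightRotation : PointSet → PointSet → Set
RightRotation T T' = Σ Point λ p → Σ Point λ q → Σ Point λ r →
  p ∈ₚ T × q ∈ₚ T × r ∈ₚ T ×
  proj₁ q ≡ proj₁ p × proj₂ q < proj₂ p ×
  proj₂ r ≡ proj₂ q × proj₁ q < proj₁ r ×
  (let q' = (proj₁ r , proj₂ p) in
    (∀ a → T' a ≡ ((T a ∧ not (a ==ₚ q)) ∨ (a ==ₚ q'))) ×
    NoOtherOn T q p × NoOtherOn T q r ×
    NoOtherOn T' p q' × NoOtherOn T' r q')

RotStep : Path → PointSet → PointSet → Set
RotStep ν T T' = IsνTree ν T × IsνTree ν T' × RightRotation T T'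

RotSeq : Path → PointSet → PointSet → Set
RotSeq ν = TransClosure (RotStep ν)

-- A right rotation changes the binary tree of T only around p: the left child q
-- of p is traded for q' = (x(r), y(p)), which becomes the right child of p with
-- left subtree r and right subtree the old right subtree of p, while p adopts
-- the old left subtree of q. All other nodes keep their children, so the
-- in-order reading changes in exactly one entry, y(q) becoming y(p) > y(q).
-- That entry really occurs in b(T) because every point of a ν-tree is a node
-- of its binary tree: by maximality every point other than the root has a
-- parent.
module Submission where

open import Defs
open import Data.Bool using (Bool; true; false; T; not; _∧_; _∨_; if_then_else_)
open import Data.Bool.Properties using (∧-identityʳ; ∨-identityʳ; ∨-zeroʳ)
open import Data.Empty using (⊥; ⊥-elim)
open import Data.List using (List; []; _∷_; _++_; length)
open import Data.List.Properties using (∷-injective; ∷-injectiveˡ; ∷-injectiveʳ; ++-assoc)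
open import Data.List.Relation.Binary.Pointwise
  using (Pointwise; []; _∷_; ++⁺; Pointwise-length; transitive; antisymmetric; Pointwise-≡⇒≡)
open import Data.Maybe using (Maybe; just; nothing; maybe; is-just)
open import Data.Nat
open import Data.Nat.Induction using (<-wellFounded)
open import Data.Nat.Properties
open import Data.Product using (_×_; _,_; proj₁; proj₂)
open import Data.Product.Properties using (≡-dec)
open import Data.Sum using (_⊎_; inj₁; inj₂)
open import Data.Unit using (tt)
open import Function using (_on_; _∘_; case_of_)
open import Induction.WellFounded using (Acc; acc)
open import Relation.Binary using (DecidableEquality; Transitive; tri<; tri≈; tri>)
open import Relation.Binary.Construct.Closure.ReflexiveTransitive using (Star; ε; _◅_; _◅◅_)
open import Relation.Binary.Construct.Closure.Transitive using ([_]; _∷_)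
import Relation.Binary.Construct.On as On
open import Relation.Binary.PropositionalEquality
open import Relation.Nullary using (¬_; yes; no)

≡true⇒≢false : ∀ {b} → b ≡ true → b ≢ false
≡true⇒≢false refl ()

NoneBetween : (ℕ → Bool) → ℕ → ℕ → Set
NoneBetween P lo hi = ∀ z → lo < z → z < hi → P z ≡ false

searchDown : (ℕ → Bool) → ℕ → Maybe ℕ
searchDown P zero    = nothing
searchDown P (suc y) = if P y then just y else searchDown P y

searchUp : (ℕ → Bool) → ℕ → ℕ → Maybe ℕ
searchUp P x zero    = nothing
searchUp P x (suc k) = if P (suc x) then just (suc x) else searchUp P (suc x) k

column : PointSet → ℕ → ℕ → Bool
column S x y = S (x , y)

row : PointSet → ℕ → ℕ → Bool
row S y x = S (x , y)

nearestBelow≡searchDown : ∀ S x y → nearestBelow S x y ≡ searchDown (column S x) y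
nearestBelow≡searchDown S x zero    = refl
nearestBelow≡searchDown S x (suc y) with S (x , y)
... | true  = refl
... | false = nearestBelow≡searchDown S x y

nearestRight≡searchUp : ∀ S y x k → nearestRight S y x k ≡ searchUp (row S y) x k
nearestRight≡searchUp S y x zero    = refl
nearestRight≡searchUp S y x (suc k) with S (suc x , y)
... | true  = refl
... | false = nearestRight≡searchUp S y (suc x) k

module _ (P : ℕ → Bool) where

  searchDown-sound : ∀ y {y'} → searchDown P y ≡ just y' →
    y' < y × P y' ≡ true × NoneBetween P y' y
  searchDown-sound (suc y) e with P y in Py
  searchDown-sound (suc y) refl | true = ≤-refl , Py , λ z y<z z<1+y → ⊥-elim (<⇒≱ y<z (≤-pred z<1+y))
  ... | false with searchDown-sound y e
  ... | y'<y , Py' , gap = m<n⇒m<1+n y'<y , Py' , gap′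
    where
    gap′ : NoneBetween P _ (suc y)
    gap′ z y'<z z<1+y with m≤n⇒m<n∨m≡n (≤-pred z<1+y)
    ... | inj₁ z<y  = gap z y'<z z<y
    ... | inj₂ refl = Py

  searchDown-none : ∀ y → searchDown P y ≡ nothing → ∀ z → z < y → P z ≡ false
  searchDown-none (suc y) e z z<1+y with P y in Py
  searchDown-none (suc y) () z z<1+y | true
  ... | false with m≤n⇒m<n∨m≡n (≤-pred z<1+y)
  ... | inj₁ z<y  = searchDown-none y e z z<y
  ... | inj₂ refl = Py

  searchDown-complete : ∀ y {y'} → y' < y → P y' ≡ true → NoneBetween P y' y →
    searchDown P y ≡ just y'
  searchDown-complete (suc y) y'<1+y Py' gap with m≤n⇒m<n∨m≡n (≤-pred y'<1+y)
  ... | inj₂ refl rewrite Py' = refl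
  ... | inj₁ y'<y rewrite gap y y'<y ≤-refl =
    searchDown-complete y y'<y Py' (λ z y'<z z<y → gap z y'<z (m<n⇒m<1+n z<y))

  searchDown-skip : ∀ y w → w ≤ y → (∀ z → w ≤ z → z < y → P z ≡ false) →
    searchDown P y ≡ searchDown P w
  searchDown-skip zero    zero w≤y none = refl
  searchDown-skip (suc y) w w≤1+y none with m≤n⇒m<n∨m≡n w≤1+y
  ... | inj₂ refl = refl
  ... | inj₁ w<1+y rewrite none y (≤-pred w<1+y) ≤-refl =
    searchDown-skip y w (≤-pred w<1+y) (λ z w≤z z<y → none z w≤z (m<n⇒m<1+n z<y))

module _ (P Q : ℕ → Bool) where

  searchDown-cong : ∀ y → (∀ z → z < y → P z ≡ Q z) → searchDown P y ≡ searchDown Q y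
  searchDown-cong zero    agree = refl
  searchDown-cong (suc y) agree rewrite agree y ≤-refl with Q y
  ... | true  = refl
  ... | false = searchDown-cong y (λ z z<y → agree z (m<n⇒m<1+n z<y))

  searchDown-cong-above : ∀ y w → w < y → P w ≡ true →
    (∀ z → w ≤ z → z < y → P z ≡ Q z) → searchDown P y ≡ searchDown Q y
  searchDown-cong-above (suc y) w w<1+y Pw agree rewrite agree y (≤-pred w<1+y) ≤-refl with Q y in Qy
  ... | true  = refl
  ... | false with m≤n⇒m<n∨m≡n (≤-pred w<1+y)
  ... | inj₂ refl = ⊥-elim (≡true⇒≢false Pw (trans (agree y ≤-refl ≤-refl) Qy))
  ... | inj₁ w<y = searchDown-cong-above y w w<y Pw (λ z w≤z z<y → agree z w≤z (m<n⇒m<1+n z<y))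

module _ (P : ℕ → Bool) where

  searchUp-sound : ∀ x k {x'} → searchUp P x k ≡ just x' →
    x < x' × x' ≤ x + k × P x' ≡ true × NoneBetween P x x'
  searchUp-sound x (suc k) {x'} e with P (suc x) in Px
  searchUp-sound x (suc k) refl | true =
    ≤-refl , m<m+n x z<s , Px , λ z x<z z<1+x → ⊥-elim (<⇒≱ x<z (≤-pred z<1+x))
  ... | false with searchUp-sound (suc x) k e
  ... | x<x' , x'≤ , Px' , gap = <-trans (n<1+n x) x<x' , subst (x' ≤_) (sym (+-suc x k)) x'≤ , Px' , gap′
    where
    gap′ : NoneBetween P x _
    gap′ z x<z z<x' with m≤n⇒m<n∨m≡n x<z
    ... | inj₁ 1+x<z = gap z 1+x<z z<x'
    ... | inj₂ refl  = Px

  searchUp-none : ∀ x k → searchUp P x k ≡ nothing → ∀ z → x < z → z ≤ x + k → P z ≡ false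
  searchUp-none x zero    e z x<z z≤x+0 = ⊥-elim (<⇒≱ x<z (subst (z ≤_) (+-identityʳ x) z≤x+0))
  searchUp-none x (suc k) e z x<z z≤ with P (suc x) in Px
  searchUp-none x (suc k) () z x<z z≤ | true
  ... | false with m≤n⇒m<n∨m≡n x<z
  ... | inj₁ 1+x<z = searchUp-none (suc x) k e z 1+x<z (subst (z ≤_) (+-suc x k) z≤)
  ... | inj₂ refl  = Px

  searchUp-complete : ∀ x k {x'} → x < x' → x' ≤ x + k → P x' ≡ true → NoneBetween P x x' →
    searchUp P x k ≡ just x'
  searchUp-complete x zero {x'} x<x' x'≤x+0 Px' gap = ⊥-elim (<⇒≱ x<x' (subst (x' ≤_) (+-identityʳ x) x'≤x+0))
  searchUp-complete x (suc k) {x'} x<x' x'≤ Px' gap with m≤n⇒m<n∨m≡n x<x'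
  ... | inj₂ refl rewrite Px' = refl
  ... | inj₁ 1+x<x' rewrite gap (suc x) ≤-refl 1+x<x' =
    searchUp-complete (suc x) k 1+x<x' (subst (x' ≤_) (+-suc x k) x'≤) Px'
      (λ z 1+x<z z<x' → gap z (<-trans (n<1+n x) 1+x<z) z<x')

  searchUp-skip : ∀ x k w → x ≤ w → w ≤ x + k → (∀ z → x < z → z ≤ w → P z ≡ false) →
    searchUp P x k ≡ searchUp P w (k ∸ (w ∸ x))
  searchUp-skip x k w x≤w w≤ none with m≤n⇒m<n∨m≡n x≤w
  ... | inj₂ refl rewrite n∸n≡0 x = refl
  searchUp-skip x zero    w x≤w w≤ none | inj₁ x<w = ⊥-elim (<⇒≱ x<w (subst (w ≤_) (+-identityʳ x) w≤))
  searchUp-skip x (suc k) w x≤w w≤ none | inj₁ x<w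
    rewrite none (suc x) ≤-refl x<w
          | searchUp-skip (suc x) k w x<w (subst (w ≤_) (+-suc x k) w≤) (λ z 1+x<z z≤w → none z (<-trans (n<1+n x) 1+x<z) z≤w)
          | +-∸-assoc 1 x<w = refl

module _ (P Q : ℕ → Bool) where

  searchUp-cong : ∀ x k → (∀ z → x < z → z ≤ x + k → P z ≡ Q z) → searchUp P x k ≡ searchUp Q x k
  searchUp-cong x zero    agree = refl
  searchUp-cong x (suc k) agree rewrite agree (suc x) ≤-refl (m<m+n x z<s) with Q (suc x)
  ... | true  = refl
  ... | false = searchUp-cong (suc x) k (λ z 1+x<z z≤ → agree z (<-trans (n<1+n x) 1+x<z) (subst (z ≤_) (sym (+-suc x k)) z≤))

  searchUp-cong-below : ∀ x k w → x < w → w ≤ x + k → P w ≡ true →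
    (∀ z → x < z → z ≤ w → P z ≡ Q z) → searchUp P x k ≡ searchUp Q x k
  searchUp-cong-below x zero    w x<w w≤ Pw agree = refl
  searchUp-cong-below x (suc k) w x<w w≤ Pw agree rewrite agree (suc x) ≤-refl x<w with Q (suc x) in Qx
  ... | true  = refl
  ... | false with m≤n⇒m<n∨m≡n x<w
  ... | inj₂ refl  = ⊥-elim (≡true⇒≢false Pw (trans (agree (suc x) ≤-refl ≤-refl) Qx))
  ... | inj₁ 1+x<w = searchUp-cong-below (suc x) k w 1+x<w (subst (w ≤_) (+-suc x k) w≤) Pw
    (λ z 1+x<z z≤w → agree z (<-trans (n<1+n x) 1+x<z) z≤w)

nearestBelow-sound : ∀ S x y {y'} → nearestBelow S x y ≡ just y' →
  y' < y × (x , y') ∈ₚ S × NoneBetween (column S x) y' y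
nearestBelow-sound S x y e = searchDown-sound (column S x) y (trans (sym (nearestBelow≡searchDown S x y)) e)

nearestBelow-complete : ∀ S x y {y'} → y' < y → (x , y') ∈ₚ S → NoneBetween (column S x) y' y →
  nearestBelow S x y ≡ just y'
nearestBelow-complete S x y y'<y y'∈ gap =
  trans (nearestBelow≡searchDown S x y) (searchDown-complete (column S x) y y'<y y'∈ gap)

nearestRight-sound : ∀ S y x m {x'} → x ≤ m → nearestRight S y x (m ∸ x) ≡ just x' →
  x < x' × x' ≤ m × (x' , y) ∈ₚ S × NoneBetween (row S y) x x'
nearestRight-sound S y x m {x'} x≤m e
  with searchUp-sound (row S y) x (m ∸ x) (trans (sym (nearestRight≡searchUp S y x (m ∸ x))) e)
... | x<x' , x'≤ , x'∈ , gap = x<x' , subst (x' ≤_) (m+[n∸m]≡n x≤m) x'≤ , x'∈ , gap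

nearestRight-complete : ∀ S y x m {x'} → x < x' → x' ≤ m → (x' , y) ∈ₚ S → NoneBetween (row S y) x x' →
  nearestRight S y x (m ∸ x) ≡ just x'
nearestRight-complete S y x m {x'} x<x' x'≤m x'∈ gap =
  trans (nearestRight≡searchUp S y x (m ∸ x))
    (searchUp-complete (row S y) x (m ∸ x) x<x' (subst (x' ≤_) (sym (m+[n∸m]≡n (≤-trans (<⇒≤ x<x') x'≤m))) x'≤m) x'∈ gap)

NoOtherOn-column : ∀ {S x y y'} → NoOtherOn S (x , y) (x , y') → NoneBetween (column S x) y y'
NoOtherOn-column {S} {x} clear z y<z z<y' with S (x , z) in z∈
... | false = refl
... | true with clear (x , z) z∈ (≤-refl , ≤-refl , <⇒≤ y<z , <⇒≤ z<y')
... | inj₁ refl = ⊥-elim (<-irrefl refl y<z)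
... | inj₂ refl = ⊥-elim (<-irrefl refl z<y')

NoOtherOn-row : ∀ {S x x' y} → NoOtherOn S (x , y) (x' , y) → NoneBetween (row S y) x x'
NoOtherOn-row {S} {y = y} clear z x<z z<x' with S (z , y) in z∈
... | false = refl
... | true with clear (z , y) z∈ (<⇒≤ x<z , <⇒≤ z<x' , ≤-refl , ≤-refl)
... | inj₁ refl = ⊥-elim (<-irrefl refl x<z)
... | inj₂ refl = ⊥-elim (<-irrefl refl z<x')

_≟ₚ_ : DecidableEquality Point
_≟ₚ_ = ≡-dec _≟_ _≟_

≢-byX : ∀ {x x' y y' : ℕ} → x ≢ x' → (x , y) ≢ (x' , y')
≢-byX x≢x' refl = x≢x' refl

≢-byY : ∀ {x x' y y' : ℕ} → y ≢ y' → (x , y) ≢ (x' , y')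
≢-byY y≢y' refl = y≢y' refl

==ₚ⇒≡ : ∀ a b → (a ==ₚ b) ≡ true → a ≡ b
==ₚ⇒≡ (x₁ , y₁) (x₂ , y₂) e with x₁ ≡ᵇ x₂ in ex | y₁ ≡ᵇ y₂ in ey
... | true | true = cong₂ _,_ (≡ᵇ⇒≡ x₁ x₂ (subst T (sym ex) tt)) (≡ᵇ⇒≡ y₁ y₂ (subst T (sym ey) tt))

==ₚ-refl : ∀ a → (a ==ₚ a) ≡ true
==ₚ-refl (x , y) with x ≡ᵇ x in ex | y ≡ᵇ y in ey | ≡⇒≡ᵇ x x refl | ≡⇒≡ᵇ y y refl
... | true | true | _ | _ = refl

≢⇒==ₚ-false : ∀ a b → a ≢ b → (a ==ₚ b) ≡ false
≢⇒==ₚ-false a b a≢b with a ==ₚ b in e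
... | true  = ⊥-elim (a≢b (==ₚ⇒≡ a b e))
... | false = refl

lowAt-mono : ∀ ν {x x'} → x ≤ x' → lowAt ν x ≤ lowAt ν x'
lowAt-mono ν       {zero}            x≤x' = z≤n
lowAt-mono []      {suc x} {suc x'} x≤x' = ≤-refl
lowAt-mono (N ∷ ν) {suc x} {suc x'} x≤x' = s≤s (lowAt-mono ν x≤x')
lowAt-mono (E ∷ ν) {suc x} {suc x'} x≤x' = lowAt-mono ν (≤-pred x≤x')

InA-upLeft : ∀ ν {x y x' y'} → InA ν (x , y) → x' ≤ x → y ≤ y' → y' ≤ height ν → InA ν (x' , y')
InA-upLeft ν (x≤m , _ , low≤y) x'≤x y≤y' y'≤n =
  ≤-trans x'≤x x≤m , y'≤n , ≤-trans (lowAt-mono ν x'≤x) (≤-trans low≤y y≤y')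

RectIn-fromCorner : ∀ ν {x₁ y₁ x₂ y₂} → InA ν (x₂ , y₁) → y₂ ≤ height ν → RectIn ν (x₁ , y₁) (x₂ , y₂)
RectIn-fromCorner ν corner y₂≤n x y _ x≤x₂ y₁≤y y≤y₂ = InA-upLeft ν corner x≤x₂ y₁≤y (≤-trans y≤y₂ y₂≤n)

Incompatible-fromCorner : ∀ ν {x₁ y₁ x₂ y₂} → x₁ < x₂ → y₁ < y₂ → InA ν (x₂ , y₁) → y₂ ≤ height ν →
  Incompatible ν (x₁ , y₁) (x₂ , y₂)
Incompatible-fromCorner ν x₁<x₂ y₁<y₂ corner y₂≤n = inj₁ ((x₁<x₂ , y₁<y₂) , RectIn-fromCorner ν corner y₂≤n)

RectIn-shrink : ∀ ν {x₁ y₁ x₂ y₂ x₁' y₁' x₂' y₂'} → RectIn ν (x₁ , y₁) (x₂ , y₂) →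
  x₁ ≤ x₁' → y₁ ≤ y₁' → x₂' ≤ x₂ → y₂' ≤ y₂ → RectIn ν (x₁' , y₁') (x₂' , y₂')
RectIn-shrink ν R x₁≤ y₁≤ ≤x₂ ≤y₂ x y x₁'≤x x≤x₂' y₁'≤y y≤y₂' =
  R x y (≤-trans x₁≤ x₁'≤x) (≤-trans x≤x₂' ≤x₂) (≤-trans y₁≤ y₁'≤y) (≤-trans y≤y₂' ≤y₂)

Incompatible-sym : ∀ ν a b → Incompatible ν a b → Incompatible ν b a
Incompatible-sym ν a b (inj₁ i) = inj₂ i
Incompatible-sym ν a b (inj₂ i) = inj₁ i

Incompatible-irrefl : ∀ ν a → ¬ Incompatible ν a a
Incompatible-irrefl ν a (inj₁ ((x<x , _) , _)) = <-irrefl refl x<x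
Incompatible-irrefl ν a (inj₂ ((x<x , _) , _)) = <-irrefl refl x<x

module νTree (ν : Path) {T : PointSet} (tree : IsνTree ν T) where

  m n : ℕ
  m = width ν
  n = height ν

  ∈⇒InA : ∀ a → a ∈ₚ T → InA ν a
  ∈⇒InA = proj₁ (proj₁ tree)

  ∈-compatible : ∀ a b → a ∈ₚ T → b ∈ₚ T → ¬ Incompatible ν a b
  ∈-compatible = proj₂ (proj₁ tree)

  ∈⇒≤n : ∀ {x y} → (x , y) ∈ₚ T → y ≤ n
  ∈⇒≤n {x} {y} a∈ = proj₁ (proj₂ (∈⇒InA (x , y) a∈))

  compatible⇒∈ : ∀ z → InA ν z → (∀ s → s ∈ₚ T → ¬ Incompatible ν z s) → z ∈ₚ T
  compatible⇒∈ z z∈A z-compatible = proj₂ tree S (S⊆A , S-compatible) T⊆S z z∈S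
    where
    S : PointSet
    S a = T a ∨ (a ==ₚ z)
    T⊆S : T ⊆ₚ S
    T⊆S a a∈T rewrite a∈T = refl
    z∈S : z ∈ₚ S
    z∈S rewrite ==ₚ-refl z = ∨-zeroʳ (T z)
    ∈S⇒∈T⊎≡z : ∀ a → a ∈ₚ S → a ∈ₚ T ⊎ a ≡ z
    ∈S⇒∈T⊎≡z a a∈S with T a in a∈T
    ... | true  = inj₁ refl
    ... | false = inj₂ (==ₚ⇒≡ a z a∈S)
    S⊆A : ∀ a → a ∈ₚ S → InA ν a
    S⊆A a a∈S with ∈S⇒∈T⊎≡z a a∈S
    ... | inj₁ a∈T = ∈⇒InA a a∈T
    ... | inj₂ refl = z∈A
    S-compatible : ∀ a b → a ∈ₚ S → b ∈ₚ S → Compatible ν a b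
    S-compatible a b a∈S b∈S with ∈S⇒∈T⊎≡z a a∈S | ∈S⇒∈T⊎≡z b b∈S
    ... | inj₁ a∈T  | inj₁ b∈T  = ∈-compatible a b a∈T b∈T
    ... | inj₁ a∈T  | inj₂ refl = z-compatible a a∈T ∘ Incompatible-sym ν a z
    ... | inj₂ refl | inj₁ b∈T  = z-compatible b b∈T
    ... | inj₂ refl | inj₂ refl = Incompatible-irrefl ν z

  root∈ : (0 , n) ∈ₚ T
  root∈ = compatible⇒∈ (0 , n) (z≤n , ≤-refl , z≤n) nothing-northeast
    where
    nothing-northeast : ∀ s → s ∈ₚ T → ¬ Incompatible ν (0 , n) s
    nothing-northeast s s∈T (inj₁ ((_ , n<y) , _)) = <⇒≱ n<y (∈⇒≤n s∈T)
    nothing-northeast s s∈T (inj₂ ((() , _) , _))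

  -- (x , y') is compatible with everything: whatever would conflict with it
  -- already conflicts with (x , y) or with (x' , y'), or lies in an empty region.
  corner∈ : ∀ {x y x' y'} → (x , y) ∈ₚ T → (x' , y') ∈ₚ T → x' < x → y < y' →
    (∀ c → c < x → T (c , y) ≡ false) →
    NoneBetween (column T x') y y' →
    (∀ c → x' < c → c < x → ∀ z → y < z → z ≤ n → T (c , z) ≡ false) →
    (x , y') ∈ₚ T
  corner∈ {x} {y} {x'} {y'} p∈ q∈ x'<x y<y' rowEmpty colGap columnsEmpty =
    compatible⇒∈ (x , y') (InA-upLeft ν (∈⇒InA _ p∈) ≤-refl (<⇒≤ y<y') (∈⇒≤n q∈)) compatible
    where
    compatible : ∀ s → s ∈ₚ T → ¬ Incompatible ν (x , y') s
    compatible (xs , ys) s∈ (inj₁ ((x<xs , y'<ys) , R)) =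
      ∈-compatible _ _ q∈ s∈ (Incompatible-fromCorner ν (<-trans x'<x x<xs) y'<ys
        (R xs y' (<⇒≤ x<xs) ≤-refl ≤-refl (<⇒≤ y'<ys)) (∈⇒≤n s∈))
    compatible (xs , ys) s∈ (inj₂ ((xs<x , ys<y') , R)) with <-cmp ys y
    ... | tri< ys<y _ _ =
      ∈-compatible _ _ s∈ p∈ (inj₁ ((xs<x , ys<y) , RectIn-shrink ν R ≤-refl ≤-refl ≤-refl (<⇒≤ y<y')))
    ... | tri≈ _ refl _ = ≡true⇒≢false s∈ (rowEmpty xs xs<x)
    ... | tri> _ _ y<ys with <-cmp xs x'
    ... | tri< xs<x' _ _ =
      ∈-compatible _ _ s∈ q∈ (inj₁ ((xs<x' , ys<y') , RectIn-shrink ν R ≤-refl ≤-refl (<⇒≤ x'<x) ≤-refl))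
    ... | tri≈ _ refl _ = ≡true⇒≢false s∈ (colGap ys y<ys ys<y')
    ... | tri> _ _ x'<xs = ≡true⇒≢false s∈ (columnsEmpty xs x'<xs xs<x ys y<ys (∈⇒≤n s∈))

  -- Otherwise take the nearest column x' < x with a point of T above row y (column 0
  -- holds the root) and the lowest such point (x' , y'); corner∈ then puts (x , y')
  -- into T, above (x , y).
  orphan⇒root : ∀ {x y} → (x , y) ∈ₚ T →
    (∀ z → y < z → z ≤ n → T (x , z) ≡ false) → (∀ c → c < x → T (c , y) ≡ false) →
    (x , y) ≡ (0 , n)
  orphan⇒root {zero} p∈ nothingAbove _ with m≤n⇒m<n∨m≡n (∈⇒≤n p∈)
  ... | inj₂ refl = refl
  ... | inj₁ y<n  = ⊥-elim (≡true⇒≢false root∈ (nothingAbove n y<n ≤-refl))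
  orphan⇒root {x@(suc _)} {y} p∈ nothingAbove nothingLeft = ⊥-elim contradiction
    where
    y+[n∸y]≡n : y + (n ∸ y) ≡ n
    y+[n∸y]≡n = m+[n∸m]≡n (∈⇒≤n p∈)
    y<n : y < n
    y<n with m≤n⇒m<n∨m≡n (∈⇒≤n p∈)
    ... | inj₁ y<n  = y<n
    ... | inj₂ refl = ⊥-elim (≡true⇒≢false root∈ (nothingLeft 0 z<s))
    above : ℕ → Maybe ℕ
    above c = searchUp (column T c) y (n ∸ y)
    occupied : ℕ → Bool
    occupied c = is-just (above c)
    unoccupied : ∀ c → occupied c ≡ false → ∀ z → y < z → z ≤ n → T (c , z) ≡ false
    unoccupied c free z y<z z≤top with above c in e
    ... | nothing = searchUp-none (column T c) y (n ∸ y) e z y<z (subst (z ≤_) (sym y+[n∸y]≡n) z≤top)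
    contradiction : ⊥
    contradiction with searchDown occupied x in e
    ... | nothing = ≡true⇒≢false root∈ (unoccupied 0 (searchDown-none occupied x e 0 z<s) n y<n ≤-refl)
    ... | just x' with searchDown-sound occupied x e
    ... | x'<x , busy , gap with above x' in e'
    ... | just y' with searchUp-sound (column T x') y (n ∸ y) e'
    ... | y<y' , y'≤ , q∈ , colGap =
      ≡true⇒≢false (corner∈ p∈ q∈ x'<x y<y' nothingLeft colGap (λ c x'<c c<x → unoccupied c (gap c x'<c c<x)))
        (nothingAbove y' y<y' (subst (y' ≤_) y+[n∸y]≡n y'≤))

  data Child : Point → Point → Set where
    leftChild  : ∀ {x y y'} → nearestBelow T x y ≡ just y' → Child (x , y) (x , y')
    rightChild : ∀ {x y x'} → nearestRight T y x (m ∸ x) ≡ just x' → Child (x , y) (x' , y)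

  _⇝_ : Point → Point → Set
  _⇝_ = Star Child

  depth : Point → ℕ
  depth (x , y) = x + (n ∸ y)

  root⇝-acc : ∀ u → Acc (_<_ on depth) u → u ∈ₚ T → (0 , n) ⇝ u
  root⇝-acc (x , y) (acc smaller) u∈ with (x , y) ≟ₚ (0 , n)
  ... | yes refl = ε
  ... | no u≢root with searchUp (column T x) y (n ∸ y) in eAbove
  ... | just y' with searchUp-sound (column T x) y (n ∸ y) eAbove
  ... | y<y' , y'≤ , parent∈ , gap =
    root⇝-acc (x , y') (smaller shallower) parent∈ ◅◅ (leftChild (nearestBelow-complete T x y' y<y' u∈ gap) ◅ ε)
    where
    shallower : depth (x , y') < depth (x , y)
    shallower = +-monoʳ-< x (∸-monoʳ-< y<y' (subst (y' ≤_) (m+[n∸m]≡n (∈⇒≤n u∈)) y'≤))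
  root⇝-acc (x , y) (acc smaller) u∈ | no u≢root | nothing with searchDown (row T y) x in eLeft
  ... | just x' with searchDown-sound (row T y) x eLeft
  ... | x'<x , parent∈ , gap =
    root⇝-acc (x' , y) (smaller (+-monoˡ-< (n ∸ y) x'<x)) parent∈ ◅◅
      (rightChild (nearestRight-complete T y x' m x'<x (proj₁ (∈⇒InA _ u∈)) u∈ gap) ◅ ε)
  root⇝-acc (x , y) (acc smaller) u∈ | no u≢root | nothing | nothing =
    ⊥-elim (u≢root (orphan⇒root u∈
      (λ z y<z z≤top → searchUp-none (column T x) y (n ∸ y) eAbove z y<z (subst (z ≤_) (sym (m+[n∸m]≡n (∈⇒≤n u∈))) z≤top))
      (searchDown-none (row T y) x eLeft)))

  root⇝ : ∀ u → u ∈ₚ T → (0 , n) ⇝ u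
  root⇝ u = root⇝-acc u (On.wellFounded depth <-wellFounded u)

_⊏_ : List ℕ → List ℕ → Set
xs ⊏ ys = Pointwise _≤_ xs ys × xs ≢ ys

⊏-trans : Transitive _⊏_
⊏-trans (xs≤ys , xs≢ys) (ys≤zs , _) =
  transitive ≤-trans xs≤ys ys≤zs ,
  λ xs≡zs → xs≢ys (Pointwise-≡⇒≡ (antisymmetric ≤-antisym xs≤ys (subst (Pointwise _≤_ _) (sym xs≡zs) ys≤zs)))

++-injective : ∀ {A : Set} {xs xs' ys ys' : List A} → length xs ≡ length xs' →
  xs ++ ys ≡ xs' ++ ys' → xs ≡ xs' × ys ≡ ys'
++-injective {xs = []}     {[]}       _ e = refl , e
++-injective {xs = x ∷ xs} {x' ∷ xs'} ∣xs∣≡∣xs'∣ e with ∷-injective e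
... | refl , e' with ++-injective {xs = xs} {xs'} (suc-injective ∣xs∣≡∣xs'∣) e'
... | refl , ys≡ys' = refl , ys≡ys'

++-≢ˡ : ∀ {xs xs' ys ys' : List ℕ} → Pointwise _≤_ xs xs' → xs ≢ xs' → xs ++ ys ≢ xs' ++ ys'
++-≢ˡ xs≤xs' xs≢xs' = xs≢xs' ∘ proj₁ ∘ ++-injective (Pointwise-length xs≤xs')

++-≢ʳ : ∀ {xs xs' ys ys' : List ℕ} → Pointwise _≤_ xs xs' → ys ≢ ys' → xs ++ ys ≢ xs' ++ ys'
++-≢ʳ xs≤xs' ys≢ys' = ys≢ys' ∘ proj₂ ∘ ++-injective (Pointwise-length xs≤xs')

⊏-++-∷ : ∀ {xs xs' ys ys' : List ℕ} {y y'} → Pointwise _≤_ xs xs' → y < y' → Pointwise _≤_ ys ys' →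
  (xs ++ y ∷ ys) ⊏ (xs' ++ y' ∷ ys')
⊏-++-∷ xs≤xs' y<y' ys≤ys' = ++⁺ xs≤xs' (<⇒≤ y<y' ∷ ys≤ys') , <⇒≢ y<y' ∘ ∷-injectiveˡ ∘ proj₂ ∘ ++-injective (Pointwise-length xs≤xs')

-- the in-order readings at p before and after a rotation, y and y' being the heights of q and p
⊏-rotate : ∀ {ls ls' ss ss' rs rs' : List ℕ} {y y'} →
  Pointwise _≤_ ls ls' → y < y' → Pointwise _≤_ ss ss' → Pointwise _≤_ rs rs' →
  ((ls ++ y ∷ ss) ++ y' ∷ rs) ⊏ (ls' ++ y' ∷ ss' ++ y' ∷ rs')
⊏-rotate {ls} {ss = ss} {rs = rs} {y = y} {y' = y'} ls≤ y<y' ss≤ rs≤ rewrite ++-assoc ls (y ∷ ss) (y' ∷ rs) =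
  ⊏-++-∷ ls≤ y<y' (++⁺ ss≤ (≤-refl ∷ rs≤))

module RightRotationStep (ν : Path) {T T' : PointSet} (tree : IsνTree ν T) (tree' : IsνTree ν T')
  {x₀ x₁ y₁ y₂ : ℕ} (p∈ : (x₀ , y₂) ∈ₚ T) (q∈ : (x₀ , y₁) ∈ₚ T) (r∈ : (x₁ , y₁) ∈ₚ T)
  (y₁<y₂ : y₁ < y₂) (x₀<x₁ : x₀ < x₁)
  (T'-def : ∀ z → T' z ≡ ((T z ∧ not (z ==ₚ (x₀ , y₁))) ∨ (z ==ₚ (x₁ , y₂))))
  (pq-clear : NoOtherOn T (x₀ , y₁) (x₀ , y₂)) (qr-clear : NoOtherOn T (x₀ , y₁) (x₁ , y₁))
  (pq'-clear : NoOtherOn T' (x₀ , y₂) (x₁ , y₂)) (rq'-clear : NoOtherOn T' (x₁ , y₁) (x₁ , y₂)) where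

  open νTree ν tree

  p q r q' : Point
  p  = (x₀ , y₂)
  q  = (x₀ , y₁)
  r  = (x₁ , y₁)
  q' = (x₁ , y₂)

  T'≡T : ∀ z → z ≢ q → z ≢ q' → T' z ≡ T z
  T'≡T z z≢q z≢q' rewrite T'-def z | ≢⇒==ₚ-false z q z≢q | ≢⇒==ₚ-false z q' z≢q'
    = trans (∨-identityʳ _) (∧-identityʳ (T z))

  q∉T' : T' q ≡ false
  q∉T' rewrite T'-def q | ==ₚ-refl q | ≢⇒==ₚ-false q q' (≢-byY (<⇒≢ y₁<y₂)) | q∈ = refl

  q'∈T' : q' ∈ₚ T'
  q'∈T' rewrite T'-def q' | ==ₚ-refl q' = ∨-zeroʳ _

  r∈T' : r ∈ₚ T'
  r∈T' = trans (T'≡T r (≢-byX (>⇒≢ x₀<x₁)) (≢-byY (<⇒≢ y₁<y₂))) r∈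

  -- otherwise T' ⊆ T, and maximality of T' would put q back into T'
  q'∉T : T q' ≡ false
  q'∉T with T q' in q'∈
  ... | false = refl
  ... | true  = ⊥-elim (≡true⇒≢false (proj₂ tree' T (proj₁ tree) T'⊆T q q∈) q∉T')
    where
    T'⊆T : T' ⊆ₚ T
    T'⊆T z z∈ with z ≟ₚ q | z ≟ₚ q'
    ... | yes refl | _        = ⊥-elim (≡true⇒≢false z∈ q∉T')
    ... | no _     | yes refl = q'∈
    ... | no z≢q   | no z≢q'  = trans (sym (T'≡T z z≢q z≢q')) z∈

  column-pq-empty : NoneBetween (column T x₀) y₁ y₂
  column-pq-empty = NoOtherOn-column pq-clear

  row-qr-empty : NoneBetween (row T y₁) x₀ x₁
  row-qr-empty = NoOtherOn-row qr-clear

  row-pq'-empty : NoneBetween (row T y₂) x₀ x₁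
  row-pq'-empty c x₀<c c<x₁ =
    trans (sym (T'≡T (c , y₂) (≢-byY (>⇒≢ y₁<y₂)) (≢-byX (<⇒≢ c<x₁)))) (NoOtherOn-row pq'-clear c x₀<c c<x₁)

  -- such a point would be incompatible with p, the rectangle's lower-right corner q being in A_ν
  row-left-of-q-empty : ∀ c → c < x₀ → T (c , y₁) ≡ false
  row-left-of-q-empty c c<x₀ with T (c , y₁) in c∈
  ... | false = refl
  ... | true  = ⊥-elim (∈-compatible _ p c∈ p∈ (Incompatible-fromCorner ν c<x₀ y₁<y₂ (∈⇒InA q q∈) (∈⇒≤n p∈)))

  column-above-r-empty : ∀ z → y₁ < z → T (x₁ , z) ≡ false
  column-above-r-empty z y₁<z with T (x₁ , z) in z∈
  ... | false = refl
  ... | true  = ⊥-elim (∈-compatible q _ q∈ z∈ (Incompatible-fromCorner ν x₀<x₁ y₁<z (∈⇒InA r r∈) (∈⇒≤n z∈)))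

  p∈T' : p ∈ₚ T'
  p∈T' = trans (T'≡T p (≢-byY (>⇒≢ y₁<y₂)) (≢-byX (<⇒≢ x₀<x₁))) p∈

  leftChild-unchanged : ∀ {x y} → (x , y) ∈ₚ T → (x , y) ≢ p → (x , y) ≢ q →
    nearestBelow T' x y ≡ nearestBelow T x y
  leftChild-unchanged {x} {y} v∈ v≢p v≢q
    rewrite nearestBelow≡searchDown T' x y | nearestBelow≡searchDown T x y with x ≟ x₀ | x ≟ x₁
  ... | no x≢x₀ | no x≢x₁ = searchDown-cong _ _ y λ z _ → T'≡T (x , z) (≢-byX x≢x₀) (≢-byX x≢x₁)
  ... | no x≢x₀ | yes refl = searchDown-cong _ _ y λ z z<y →
    T'≡T (x₁ , z) (≢-byX x≢x₀) (≢-byY (<⇒≢ (<-≤-trans z<y (≤-trans y≤y₁ (<⇒≤ y₁<y₂)))))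
    where
    y≤y₁ : y ≤ y₁
    y≤y₁ = ≮⇒≥ λ y₁<y → ≡true⇒≢false v∈ (column-above-r-empty y y₁<y)
  ... | yes refl | _ with <-cmp y y₁
  ... | tri< y<y₁ _ _ = searchDown-cong _ _ y λ z z<y →
    T'≡T (x₀ , z) (≢-byY (<⇒≢ (<-trans z<y y<y₁))) (≢-byX (<⇒≢ x₀<x₁))
  ... | tri≈ _ refl _ = ⊥-elim (v≢q refl)
  ... | tri> _ _ y₁<y with <-cmp y y₂
  ... | tri< y<y₂ _ _ = ⊥-elim (≡true⇒≢false v∈ (column-pq-empty y y₁<y y<y₂))
  ... | tri≈ _ refl _ = ⊥-elim (v≢p refl)
  ... | tri> _ _ y₂<y = searchDown-cong-above _ _ y y₂ y₂<y p∈T' λ z y₂≤z _ →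
    T'≡T (x₀ , z) (≢-byY (>⇒≢ (<-≤-trans y₁<y₂ y₂≤z))) (≢-byX (<⇒≢ x₀<x₁))

  rightChild-unchanged : ∀ {x y} → (x , y) ∈ₚ T → (x , y) ≢ p → (x , y) ≢ q →
    nearestRight T' y x (m ∸ x) ≡ nearestRight T y x (m ∸ x)
  rightChild-unchanged {x} {y} v∈ v≢p v≢q
    rewrite nearestRight≡searchUp T' y x (m ∸ x) | nearestRight≡searchUp T y x (m ∸ x) with y ≟ y₁ | y ≟ y₂
  ... | no y≢y₁ | no y≢y₂ = searchUp-cong _ _ x (m ∸ x) λ z _ _ → T'≡T (z , y) (≢-byY y≢y₁) (≢-byY y≢y₂)
  ... | yes refl | _ with <-cmp x x₀
  ... | tri< x<x₀ _ _ = ⊥-elim (≡true⇒≢false v∈ (row-left-of-q-empty x x<x₀))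
  ... | tri≈ _ refl _ = ⊥-elim (v≢q refl)
  ... | tri> _ _ x₀<x = searchUp-cong _ _ x (m ∸ x) λ z x<z _ →
    T'≡T (z , y₁) (≢-byX (>⇒≢ (<-trans x₀<x x<z))) (≢-byY (<⇒≢ y₁<y₂))
  rightChild-unchanged {x} {y} v∈ v≢p v≢q | no _ | yes refl with <-cmp x x₀
  ... | tri< x<x₀ _ _ =
    searchUp-cong-below _ _ x (m ∸ x) x₀ x<x₀ (subst (x₀ ≤_) (sym (m+[n∸m]≡n (proj₁ (∈⇒InA _ v∈)))) (proj₁ (∈⇒InA p p∈)))
      p∈T' λ z _ z≤x₀ → T'≡T (z , y₂) (≢-byY (>⇒≢ y₁<y₂)) (≢-byX (<⇒≢ (≤-<-trans z≤x₀ x₀<x₁)))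
  ... | tri≈ _ refl _ = ⊥-elim (v≢p refl)
  ... | tri> _ _ x₀<x = searchUp-cong _ _ x (m ∸ x) λ z x<z _ →
    T'≡T (z , y₂) (≢-byY (>⇒≢ y₁<y₂)) (≢-byX (>⇒≢ (≤-<-trans x₁≤x x<z)))
    where
    x₁≤x : x₁ ≤ x
    x₁≤x = ≮⇒≥ λ x<x₁ → ≡true⇒≢false v∈ (row-pq'-empty x x₀<x x<x₁)

  x₀≤m : x₀ ≤ m
  x₀≤m = proj₁ (∈⇒InA p p∈)

  x₁≤m : x₁ ≤ m
  x₁≤m = proj₁ (∈⇒InA r r∈)

  leftChild-p : nearestBelow T x₀ y₂ ≡ just y₁
  leftChild-p = nearestBelow-complete T x₀ y₂ y₁<y₂ q∈ column-pq-empty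

  rightChild-q : nearestRight T y₁ x₀ (m ∸ x₀) ≡ just x₁
  rightChild-q = nearestRight-complete T y₁ x₀ m x₀<x₁ x₁≤m r∈ row-qr-empty

  leftChild'-p : nearestBelow T' x₀ y₂ ≡ nearestBelow T x₀ y₁
  leftChild'-p rewrite nearestBelow≡searchDown T' x₀ y₂ | nearestBelow≡searchDown T x₀ y₁ =
    trans (searchDown-skip (column T' x₀) y₂ y₁ (<⇒≤ y₁<y₂) vacated)
          (searchDown-cong _ _ y₁ λ z z<y₁ → T'≡T (x₀ , z) (≢-byY (<⇒≢ z<y₁)) (≢-byX (<⇒≢ x₀<x₁)))
    where
    vacated : ∀ z → y₁ ≤ z → z < y₂ → T' (x₀ , z) ≡ false
    vacated z y₁≤z z<y₂ with m≤n⇒m<n∨m≡n y₁≤z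
    ... | inj₂ refl = q∉T'
    ... | inj₁ y₁<z = trans (T'≡T (x₀ , z) (≢-byY (>⇒≢ y₁<z)) (≢-byX (<⇒≢ x₀<x₁))) (column-pq-empty z y₁<z z<y₂)

  rightChild'-p : nearestRight T' y₂ x₀ (m ∸ x₀) ≡ just x₁
  rightChild'-p = nearestRight-complete T' y₂ x₀ m x₀<x₁ x₁≤m q'∈T' (NoOtherOn-row pq'-clear)

  leftChild'-q' : nearestBelow T' x₁ y₂ ≡ just y₁
  leftChild'-q' = nearestBelow-complete T' x₁ y₂ y₁<y₂ r∈T' (NoOtherOn-column rq'-clear)

  rightChild'-q' : nearestRight T' y₂ x₁ (m ∸ x₁) ≡ nearestRight T y₂ x₀ (m ∸ x₀)
  rightChild'-q' = begin
    nearestRight T' y₂ x₁ (m ∸ x₁)                 ≡⟨ nearestRight≡searchUp T' y₂ x₁ (m ∸ x₁) ⟩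
    searchUp (row T' y₂) x₁ (m ∸ x₁)               ≡⟨ searchUp-cong _ _ x₁ (m ∸ x₁) unchanged ⟩
    searchUp (row T y₂) x₁ (m ∸ x₁)                ≡⟨ cong (searchUp (row T y₂) x₁) remaining ⟨
    searchUp (row T y₂) x₁ (m ∸ x₀ ∸ (x₁ ∸ x₀))    ≡⟨ searchUp-skip (row T y₂) x₀ (m ∸ x₀) x₁ (<⇒≤ x₀<x₁) x₁≤ skipped ⟨
    searchUp (row T y₂) x₀ (m ∸ x₀)                ≡⟨ nearestRight≡searchUp T y₂ x₀ (m ∸ x₀) ⟨
    nearestRight T y₂ x₀ (m ∸ x₀)                  ∎
    where
    open ≡-Reasoning
    unchanged : ∀ z → x₁ < z → z ≤ x₁ + (m ∸ x₁) → T' (z , y₂) ≡ T (z , y₂)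
    unchanged z x₁<z _ = T'≡T (z , y₂) (≢-byY (>⇒≢ y₁<y₂)) (≢-byX (>⇒≢ x₁<z))
    remaining : m ∸ x₀ ∸ (x₁ ∸ x₀) ≡ m ∸ x₁
    remaining = trans (∸-+-assoc m x₀ (x₁ ∸ x₀)) (cong (m ∸_) (m+[n∸m]≡n (<⇒≤ x₀<x₁)))
    x₁≤ : x₁ ≤ x₀ + (m ∸ x₀)
    x₁≤ = subst (x₁ ≤_) (sym (m+[n∸m]≡n x₀≤m)) x₁≤m
    skipped : ∀ z → x₀ < z → z ≤ x₁ → T (z , y₂) ≡ false
    skipped z x₀<z z≤x₁ with m≤n⇒m<n∨m≡n z≤x₁
    ... | inj₁ z<x₁ = row-pq'-empty z x₀<z z<x₁
    ... | inj₂ refl = q'∉T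

  rightChild-p-beyond-q' : ∀ {x'} → nearestRight T y₂ x₀ (m ∸ x₀) ≡ just x' → x₁ < x'
  rightChild-p-beyond-q' {x'} e with nearestRight-sound T y₂ x₀ m x₀≤m e
  ... | x₀<x' , _ , x'∈ , _ with <-cmp x' x₁
  ... | tri< x'<x₁ _ _ = ⊥-elim (≡true⇒≢false x'∈ (row-pq'-empty x' x₀<x' x'<x₁))
  ... | tri≈ _ refl _  = ⊥-elim (≡true⇒≢false x'∈ q'∉T)
  ... | tri> _ _ x₁<x' = x₁<x'

  -- strictly decreases from a node to its children, so it bounds the fuel inorder needs
  μ : Point → ℕ
  μ (x , y) = (m ∸ x) + y

  μ-left : ∀ {x y y'} → y' < y → μ (x , y') < μ (x , y)
  μ-left {x} y'<y = +-monoʳ-< (m ∸ x) y'<y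

  μ-right : ∀ {x x' y} → x < x' → x' ≤ m → μ (x' , y) < μ (x , y)
  μ-right {y = y} x<x' x'≤m = +-monoˡ-< y (∸-monoʳ-< x<x' x'≤m)

  leftChild-step : ∀ {x y y'} → (x , y) ∈ₚ T → (x , y) ≢ p → nearestBelow T x y ≡ just y' →
    (x , y') ∈ₚ T × (x , y') ≢ q × μ (x , y') < μ (x , y)
  leftChild-step {x} {y} {y'} v∈ v≢p e with nearestBelow-sound T x y e
  ... | y'<y , y'∈ , gap = y'∈ , child≢q , μ-left {x} y'<y
    where
    child≢q : (x , y') ≢ q
    child≢q refl with <-cmp y y₂
    ... | tri< y<y₂ _ _ = ≡true⇒≢false v∈ (column-pq-empty y y'<y y<y₂)
    ... | tri≈ _ refl _ = v≢p refl
    ... | tri> _ _ y₂<y = ≡true⇒≢false p∈ (gap y₂ y₁<y₂ y₂<y)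

  rightChild-step : ∀ {x y x'} → (x , y) ∈ₚ T → nearestRight T y x (m ∸ x) ≡ just x' →
    (x' , y) ∈ₚ T × (x' , y) ≢ q × μ (x' , y) < μ (x , y)
  rightChild-step {x} {y} {x'} v∈ e with nearestRight-sound T y x m (proj₁ (∈⇒InA _ v∈)) e
  ... | x<x' , x'≤m , x'∈ , _ = x'∈ , child≢q , μ-right x<x' x'≤m
    where
    child≢q : (x' , y) ≢ q
    child≢q refl = ≡true⇒≢false v∈ (row-left-of-q-empty x x<x')

  q≢p : q ≢ p
  q≢p = ≢-byY (<⇒≢ y₁<y₂)

  r≢q : r ≢ q
  r≢q = ≢-byX (>⇒≢ x₀<x₁)

  μq<μp : μ q < μ p
  μq<μp = μ-left {x₀} y₁<y₂

  μr<μq : μ r < μ q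
  μr<μq = μ-right x₀<x₁ x₁≤m

  μr<μq' : μ r < μ q'
  μr<μq' = μ-left {x₁} y₁<y₂

  μq'<μp : μ q' < μ p
  μq'<μp = μ-right x₀<x₁ x₁≤m

  Comparison : ℕ → ℕ → Point → Set
  Comparison f f' v = Pointwise _≤_ (inorder ν T f v) (inorder ν T' f' v)
                    × (v ⇝ p → inorder ν T f v ≢ inorder ν T' f' v)

  subtree : PointSet → ℕ → (ℕ → Point) → Maybe ℕ → List ℕ
  subtree S f at = maybe (λ k → inorder ν S f (at k)) []

  SubtreeComparison : ℕ → ℕ → (ℕ → Point) → Maybe ℕ → Set
  SubtreeComparison f f' at child = Pointwise _≤_ (subtree T f at child) (subtree T' f' at child)
    × (∀ k → child ≡ just k → at k ⇝ p → subtree T f at child ≢ subtree T' f' at child)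

  subtree-compare : ∀ f f' at child → (∀ k → child ≡ just k → Comparison f f' (at k)) →
    SubtreeComparison f f' at child
  subtree-compare f f' at nothing  _   = [] , λ _ ()
  subtree-compare f f' at (just k) cmp = proj₁ (cmp k refl) , λ { _ refl → proj₂ (cmp k refl) }

  mutual
    inorder-compare : ∀ f f' v → v ∈ₚ T → v ≢ q → μ v < f → μ v < f' → Comparison f f' v
    inorder-compare (suc f) (suc f') (x , y) v∈ v≢q μ<f μ<f' with (x , y) ≟ₚ p
    ... | yes refl = inorder-compare-p f f' μ<f μ<f'
    ... | no v≢p rewrite leftChild-unchanged v∈ v≢p v≢q | rightChild-unchanged v∈ v≢p v≢q =
      ++⁺ (proj₁ L) (≤-refl ∷ proj₁ R) , λ where
        ε                     → ⊥-elim (v≢p refl)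
        (leftChild e ◅ path)  → ++-≢ˡ (proj₁ L) (proj₂ L _ e path)
        (rightChild e ◅ path) → ++-≢ʳ (proj₁ L) (proj₂ R _ e path ∘ ∷-injectiveʳ)
      where
      L : SubtreeComparison f f' (x ,_) (nearestBelow T x y)
      L = subtree-compare f f' (x ,_) _ λ k e → case leftChild-step v∈ v≢p e of λ where
        (k∈ , k≢q , μ<) → inorder-compare f f' (x , k) k∈ k≢q (<-≤-trans μ< (≤-pred μ<f)) (<-≤-trans μ< (≤-pred μ<f'))
      R : SubtreeComparison f f' (_, y) (nearestRight T y x (m ∸ x))
      R = subtree-compare f f' (_, y) _ λ k e → case rightChild-step v∈ e of λ where
        (k∈ , k≢q , μ<) → inorder-compare f f' (k , y) k∈ k≢q (<-≤-trans μ< (≤-pred μ<f)) (<-≤-trans μ< (≤-pred μ<f'))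

    inorder-compare-p : ∀ f f' → μ p < suc f → μ p < suc f' → Comparison (suc f) (suc f') p
    inorder-compare-p zero    _        μp<1 _    = ⊥-elim (<⇒≱ (≤-<-trans z≤n μq<μp) (≤-pred μp<1))
    inorder-compare-p (suc _) zero     _    μp<1 = ⊥-elim (<⇒≱ (≤-<-trans z≤n μq<μp) (≤-pred μp<1))
    inorder-compare-p (suc f) (suc f') μp<  μp<'
      rewrite leftChild-p | rightChild-q | leftChild'-p | rightChild'-p | leftChild'-q' | rightChild'-q'
      = let increased , strict = ⊏-rotate (proj₁ Lq) y₁<y₂ (proj₁ Sr) (proj₁ Rp) in increased , λ _ → strict
      where
      μq<1+f : μ q < suc f
      μq<1+f = <-≤-trans μq<μp (≤-pred μp<)
      μq<1+f' : μ q < suc f'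
      μq<1+f' = <-≤-trans μq<μp (≤-pred μp<')
      Lq : SubtreeComparison f (suc f') (x₀ ,_) (nearestBelow T x₀ y₁)
      Lq = subtree-compare f (suc f') (x₀ ,_) _ λ k e → case leftChild-step q∈ q≢p e of λ where
        (k∈ , k≢q , μ<) → inorder-compare f (suc f') (x₀ , k) k∈ k≢q (<-≤-trans μ< (≤-pred μq<1+f)) (<-trans μ< μq<1+f')
      Sr : Comparison f f' r
      Sr = inorder-compare f f' r r∈ r≢q (<-≤-trans μr<μq (≤-pred μq<1+f))
             (<-≤-trans μr<μq' (≤-pred (<-≤-trans μq'<μp (≤-pred μp<'))))
      Rp : SubtreeComparison (suc f) f' (_, y₂) (nearestRight T y₂ x₀ (m ∸ x₀))
      Rp = subtree-compare (suc f) f' (_, y₂) _ λ k e → case rightChild-step p∈ e of λ where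
        (k∈ , k≢q , μ<) → inorder-compare (suc f) f' (k , y₂) k∈ k≢q (<-≤-trans μ< (≤-pred μp<))
          (<-≤-trans (μ-right (rightChild-p-beyond-q' e) (proj₁ (∈⇒InA _ k∈))) (≤-pred (<-≤-trans μq'<μp (≤-pred μp<'))))

  root≢q : (0 , n) ≢ q
  root≢q refl = <⇒≱ y₁<y₂ (∈⇒≤n p∈)

  bvec-increases : bvec ν T ⊏ bvec ν T'
  bvec-increases =
    let increased , strict = inorder-compare (suc (m + n)) (suc (m + n)) (0 , n) root∈ root≢q ≤-refl ≤-refl
    in increased , strict (root⇝ p p∈)

rightRotation-increases : ∀ ν {T T'} → RotStep ν T T' → bvec ν T ⊏ bvec ν T'
rightRotation-increases ν (tree , tree' , (x₀ , y₂) , (_ , y₁) , (x₁ , _) , p∈ , q∈ , r∈ ,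
                           refl , y₁<y₂ , refl , x₀<x₁ , T'-def , pq-clear , qr-clear , pq'-clear , rq'-clear) =
  RightRotationStep.bvec-increases ν tree tree' p∈ q∈ r∈ y₁<y₂ x₀<x₁ T'-def pq-clear qr-clear pq'-clear rq'-clear

corollary4p10 : (ν : Path) (T T' : PointSet) →
    IsνTree ν T → IsνTree ν T' → RotSeq ν T T' →
    Pointwise _≤_ (bvec ν T) (bvec ν T') × ¬ (bvec ν T ≡ bvec ν T')
corollary4p10 ν T T' _ _ = rotations-increase
  where
  rotations-increase : ∀ {T T'} → RotSeq ν T T' → bvec ν T ⊏ bvec ν T'
  rotations-increase [ step ]        = rightRotation-increases ν step
  rotations-increase (step ∷ steps) = ⊏-trans (rightRotation-increases ν step) (rotations-increase steps)
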